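{- Let $G$ and $H$ be finite simple graphs with $i_G$ and $i_H$ isolated vertices, respectively. Then $$\rho(G\times H)\geq \max\{\rho_o(G^-)\rho(H^-),\ \rho_o(H^-)\rho(G^-)\}+i_G|V(H)|+i_H|V(G)|-i_Gi_H.$$
   Context: For a graph $G$, $G^-$ denotes the graph obtained from $G$ by removing all isolated vertices. A packing is a set $P\subseteq V(G)$ with $N_G[u]\cap N_G[v]=\emptyset$ for distinct $u,v\in P$ (closed neighborhoods), and $\rho(G)$ is the maximum size of a packing; an open packing is a set $P$ with $N_G(u)\cap N_G(v)=\emptyset$ for distinct $u,v\in P$ (open neighborhoods), and $\rho_o(G)$ is the maximum size of an open packing. The direct product $G\times H$ has vertex set $V(G)\times V(H)$, with $(g,h)$ adjacent to $(g',h')$ iff $gg'\in E(G)$ and $hh'\in E(H)$. -}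

module Defs where

open import Data.Nat using (ℕ; zero; suc; _+_; _*_; _∸_; _⊔_; _≥_)
open import Data.Bool using (Bool; true; false; not; _∧_; if_then_else_)
open import Data.Fin using (Fin; remQuot)
open import Data.Fin.Subset using (Subset; _∈_; ∣_∣)
open import Data.List using (List; []; _∷_; length; lookup; allFin; filterᵇ)
open import Data.Product using (_×_; _,_; proj₁; proj₂; Σ; ∃)
open import Data.Sum using (_⊎_)
open import Data.Empty using (⊥)
open import Relation.Binary.PropositionalEquality using (_≡_; _≢_)
open import Relation.Nullary using (¬_)

record Graph : Set where
  field
    order  : ℕ
    adj    : Fin order → Fin order → Bool
    symm   : ∀ u v → adj u v ≡ adj v u
    irrefl : ∀ v → adj v v ≡ false
open Graph public

V : Graph → Set
V G = Fin (order G)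

InOpenNbhd : (G : Graph) → V G → V G → Set
InOpenNbhd G u w = adj G u w ≡ true

InClosedNbhd : (G : Graph) → V G → V G → Set
InClosedNbhd G u w = (w ≡ u) ⊎ (adj G u w ≡ true)

IsPacking : (G : Graph) → Subset (order G) → Set
IsPacking G P = ∀ u v → u ∈ P → v ∈ P → u ≢ v →
  ∀ w → ¬ (InClosedNbhd G u w × InClosedNbhd G v w)

IsOpenPacking : (G : Graph) → Subset (order G) → Set
IsOpenPacking G P = ∀ u v → u ∈ P → v ∈ P → u ≢ v →
  ∀ w → ¬ (InOpenNbhd G u w × InOpenNbhd G v w)

IsPackingNumber : Graph → ℕ → Set
IsPackingNumber G k =
  (Σ (Subset (order G)) λ P → IsPacking G P × ∣ P ∣ ≡ k) ×
  (∀ P → IsPacking G P → k ≥ ∣ P ∣)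

IsOpenPackingNumber : Graph → ℕ → Set
IsOpenPackingNumber G k =
  (Σ (Subset (order G)) λ P → IsOpenPacking G P × ∣ P ∣ ≡ k) ×
  (∀ P → IsOpenPacking G P → k ≥ ∣ P ∣)

allᵇ : {A : Set} → (A → Bool) → List A → Bool
allᵇ p [] = true
allᵇ p (x ∷ xs) = p x ∧ allᵇ p xs

isIsolatedᵇ : (G : Graph) → V G → Bool
isIsolatedᵇ G v = allᵇ (λ w → not (adj G v w)) (allFin (order G))

isolatedList : (G : Graph) → List (V G)
isolatedList G = filterᵇ (isIsolatedᵇ G) (allFin (order G))

numIsolated : Graph → ℕ
numIsolated G = length (isolatedList G)

nonIsolatedList : (G : Graph) → List (V G)
nonIsolatedList G = filterᵇ (λ v → not (isIsolatedᵇ G v)) (allFin (order G))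

minusIsolated : Graph → Graph
minusIsolated G = record
  { order  = length (nonIsolatedList G)
  ; adj    = λ i j → adj G (emb i) (emb j)
  ; symm   = λ i j → symm G (emb i) (emb j)
  ; irrefl = λ i → irrefl G (emb i)
  }
  where
  emb : Fin (length (nonIsolatedList G)) → V G
  emb = lookup (nonIsolatedList G)

-- direct product G × H, on vertex set Fin (|V(G)| * |V(H)|) ≅ V(G) × V(H)
-- (vertices identified with pairs via remQuot)
directProduct : Graph → Graph → Graph
directProduct G H = record
  { order  = order G * order H
  ; adj    = λ x y → adj G (p1 x) (p1 y) ∧ adj H (p2 x) (p2 y)
  ; symm   = λ x y → cong2∧ (symm G (p1 x) (p1 y)) (symm H (p2 x) (p2 y))
  ; irrefl = λ x → irr (adj H (p2 x) (p2 x)) (irrefl G (p1 x))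
  }
  where
  p1 : Fin (order G * order H) → V G
  p1 x = proj₁ (remQuot {order G} (order H) x)
  p2 : Fin (order G * order H) → V H
  p2 x = proj₂ (remQuot {order G} (order H) x)
  cong2∧ : ∀ {a b c d : Bool} → a ≡ b → c ≡ d → (a ∧ c) ≡ (b ∧ d)
  cong2∧ _≡_.refl _≡_.refl = _≡_.refl
  irr : ∀ {a} (b : Bool) → a ≡ false → (a ∧ b) ≡ false
  irr b _≡_.refl = _≡_.refl

-- Take an open packing A of G⁻ and a packing B of H⁻. Every vertex of G × H
-- with an isolated coordinate is isolated, so these vertices can be added to
-- any packing. Among the pairs of A × B, a common closed neighbour (x , y) of
-- (a , b) ≠ (a' , b') is impossible: if it is one of the two pairs, then b and
-- b' are adjacent; otherwise x is a common neighbour of a and a', forcing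
-- a = a', and then y is a common neighbour of b ≠ b'. Counting the vertices
-- with an isolated coordinate (i_G |V(H)| + i_H |V(G)| − i_G i_H of them) and
-- the |A| |B| pairs gives the bound; exchanging the roles of G and H gives the
-- other term of the maximum.
module Submission where

open import Defs
open import Data.Bool using (Bool; true; false; not; _∧_; T; T?; if_then_else_)
open import Data.Bool.Properties using (T-∧; T-≡; T-not-≡; ∧-zeroʳ)
open import Data.Fin using (Fin; zero; suc; combine; remQuot; _↑ˡ_; _↑ʳ_; _≟_)
open import Data.Fin.Properties using (any?; remQuot-combine; combine-remQuot)
open import Data.Fin.Subset using (Subset; _∈_; ∣_∣)
open import Data.Fin.Subset.Properties using (_∈?_)
open import Data.List using (List; []; _∷_; map; length; filterᵇ; allFin; lookup)
import Data.List as List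
open import Data.List.Membership.Propositional using () renaming (_∈_ to _∈ᴸ_)
open import Data.List.Membership.Propositional.Properties using (∈-allFin; ∈-filter⁺)
open import Data.List.Properties using (tabulate-lookup)
open import Data.List.Relation.Unary.Any using (here; there; index)
open import Data.List.Relation.Unary.Any.Properties using (lookup-index)
open import Data.Nat using (ℕ; zero; suc; _+_; _*_; _∸_; _⊔_; _≤_; _≥_; z≤n)
open import Data.Nat.ListAction using () renaming (sum to sumᴸ)
open import Data.Nat.Properties
  using (+-*-semiring; +-commutativeSemigroup; +-assoc; +-identityʳ; *-identityʳ; *-comm;
         +-mono-≤; +-monoʳ-≤; ≤-refl; ≤-reflexive; ≤-trans; ≤-total; ⊔-lub; m+n∸n≡m; module ≤-Reasoning)
open import Algebra.Properties.Semiring.Sum +-*-semiring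
  using (sum; sum-syntax; sum-cong-≗; ∑-distrib-+; *-distribˡ-sum; *-distribʳ-sum)
open import Algebra.Properties.CommutativeSemigroup +-commutativeSemigroup using (x∙yz≈y∙xz)
open import Data.Nat.Tactic.RingSolver using (solve-∀)
open import Data.Product using (Σ; ∃; _×_; _,_; proj₁; proj₂; swap; uncurry)
open import Data.Sum using (_⊎_; inj₁; inj₂)
import Data.Sum as Sum
import Data.Vec as Vec
open import Data.Vec.Properties using (lookup∘tabulate; []=⇒lookup; lookup⇒[]=)
open import Function using (_∘_; id; Equivalence; mk⇔)
open import Relation.Binary.PropositionalEquality
  using (_≡_; refl; sym; trans; cong; cong₂; _≢_; ≢-sym; module ≡-Reasoning)
open import Relation.Nullary using (Dec; yes; no; does; ¬_; contradiction)
open import Relation.Nullary.Decidable using (_×-dec_; _⊎-dec_; dec-true; does-⇔)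
open import Level using (0ℓ)
open import Relation.Unary using (Pred; Decidable)

open Equivalence using (to; from)

∑-const : ∀ n c → ∑[ i < n ] c ≡ n * c
∑-const zero    c = refl
∑-const (suc n) c = cong (c +_) (∑-const n c)

∑-mono-≤ : ∀ {n} {f g : Fin n → ℕ} → (∀ i → f i ≤ g i) → sum f ≤ sum g
∑-mono-≤ {zero}  f≤g = z≤n
∑-mono-≤ {suc n} f≤g = +-mono-≤ (f≤g zero) (∑-mono-≤ (f≤g ∘ suc))

∑-↑ˡ-↑ʳ : ∀ m n (f : Fin (m + n) → ℕ) →
          sum f ≡ ∑[ i < m ] f (i ↑ˡ n) + ∑[ j < n ] f (m ↑ʳ j)
∑-↑ˡ-↑ʳ zero    n f = refl
∑-↑ˡ-↑ʳ (suc m) n f =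
  trans (cong (f zero +_) (∑-↑ˡ-↑ʳ m n (f ∘ suc))) (sym (+-assoc (f zero) _ _))

∑-combine : ∀ m n (f : Fin (m * n) → ℕ) →
            sum f ≡ ∑[ i < m ] ∑[ j < n ] f (combine i j)
∑-combine zero    n f = refl
∑-combine (suc m) n f =
  trans (∑-↑ˡ-↑ʳ n (m * n) f) (cong (sum (f ∘ (_↑ˡ m * n)) +_) (∑-combine m n (f ∘ (n ↑ʳ_))))

module _ {A : Set} where

  sumᴸ-map-tabulate : ∀ n (g : Fin n → A) (c : A → ℕ) →
                      sumᴸ (map c (List.tabulate g)) ≡ ∑[ i < n ] c (g i)
  sumᴸ-map-tabulate zero    g c = refl
  sumᴸ-map-tabulate (suc n) g c = cong (c (g zero) +_) (sumᴸ-map-tabulate n (g ∘ suc) c)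

  sumᴸ-map-const : ∀ k (xs : List A) → sumᴸ (map (λ _ → k) xs) ≡ length xs * k
  sumᴸ-map-const k []       = refl
  sumᴸ-map-const k (x ∷ xs) = cong (k +_) (sumᴸ-map-const k xs)

  sumᴸ-map-filterᵇ-partition : ∀ (p : A → Bool) (c : A → ℕ) xs →
    sumᴸ (map c xs) ≡ sumᴸ (map c (filterᵇ p xs)) + sumᴸ (map c (filterᵇ (not ∘ p) xs))
  sumᴸ-map-filterᵇ-partition p c []       = refl
  sumᴸ-map-filterᵇ-partition p c (x ∷ xs) with p x
  ... | true  = trans (cong (c x +_) (sumᴸ-map-filterᵇ-partition p c xs)) (sym (+-assoc (c x) _ _))
  ... | false = trans (cong (c x +_) (sumᴸ-map-filterᵇ-partition p c xs))
                      (x∙yz≈y∙xz (c x) (sumᴸ (map c (filterᵇ p xs))) _)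

  sumᴸ-map-filterᵇ-mono : ∀ (p : A → Bool) {d c : A → ℕ} → (∀ x → T (p x) → d x ≤ c x) →
    ∀ xs → sumᴸ (map d (filterᵇ p xs)) ≤ sumᴸ (map c (filterᵇ p xs))
  sumᴸ-map-filterᵇ-mono p d≤c []       = z≤n
  sumᴸ-map-filterᵇ-mono p d≤c (x ∷ xs) with p x in px
  ... | true  = +-mono-≤ (d≤c x (from T-≡ px)) (sumᴸ-map-filterᵇ-mono p d≤c xs)
  ... | false = sumᴸ-map-filterᵇ-mono p d≤c xs

𝟙 : {A : Set} → Dec A → ℕ
𝟙 a? = if does a? then 1 else 0

𝟙-yes : {A : Set} (a? : Dec A) → A → 𝟙 a? ≡ 1
𝟙-yes a? a = cong (if_then 1 else 0) (dec-true a? a)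

𝟙-mono : {A B : Set} → (A → B) → (a? : Dec A) (b? : Dec B) → 𝟙 a? ≤ 𝟙 b?
𝟙-mono A→B (no _)  _       = z≤n
𝟙-mono A→B (yes a) (yes _) = ≤-refl
𝟙-mono A→B (yes a) (no ¬b) = contradiction (A→B a) ¬b

𝟙-×-dec : {A B : Set} (a? : Dec A) (b? : Dec B) → 𝟙 (a? ×-dec b?) ≡ 𝟙 a? * 𝟙 b?
𝟙-×-dec (yes _) b? = sym (+-identityʳ (𝟙 b?))
𝟙-×-dec (no _)  b? = refl

∣p∣≡∑𝟙 : ∀ {n} (p : Subset n) → ∣ p ∣ ≡ ∑[ i < n ] 𝟙 (i ∈? p)
∣p∣≡∑𝟙 Vec.[]            = refl
∣p∣≡∑𝟙 (true  Vec.∷ p) = cong suc (∣p∣≡∑𝟙 p)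
∣p∣≡∑𝟙 (false Vec.∷ p) = ∣p∣≡∑𝟙 p

𝟙*∣p∣≡∑𝟙-×-dec : ∀ {A : Set} {n} (a? : Dec A) (p : Subset n) →
                 𝟙 a? * ∣ p ∣ ≡ ∑[ j < n ] 𝟙 (a? ×-dec j ∈? p)
𝟙*∣p∣≡∑𝟙-×-dec {n = n} a? p = begin
  𝟙 a? * ∣ p ∣                          ≡⟨ cong (𝟙 a? *_) (∣p∣≡∑𝟙 p) ⟩
  𝟙 a? * ∑[ j < n ] 𝟙 (j ∈? p)           ≡⟨ *-distribˡ-sum (𝟙 a?) (λ j → 𝟙 (j ∈? p)) ⟩
  ∑[ j < n ] (𝟙 a? * 𝟙 (j ∈? p))         ≡⟨ sum-cong-≗ (λ j → 𝟙-×-dec a? (j ∈? p)) ⟨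
  ∑[ j < n ] 𝟙 (a? ×-dec j ∈? p)         ∎
  where open ≡-Reasoning

module _ {n} {P : Pred (Fin n) 0ℓ} (P? : Decidable P) where

  toSubset : Subset n
  toSubset = Vec.tabulate (does ∘ P?)

  ∈-toSubset⁻ : ∀ {i} → i ∈ toSubset → P i
  ∈-toSubset⁻ {i} i∈ with P? i | trans (sym (lookup∘tabulate (does ∘ P?) i)) ([]=⇒lookup i∈)
  ... | yes Pi | _ = Pi

  ∈-toSubset⁺ : ∀ {i} → P i → i ∈ toSubset
  ∈-toSubset⁺ {i} Pi = lookup⇒[]= i _ (trans (lookup∘tabulate _ i) (dec-true (P? i) Pi))

  ∣toSubset∣ : ∣ toSubset ∣ ≡ ∑[ i < n ] 𝟙 (P? i)
  ∣toSubset∣ = trans (∣p∣≡∑𝟙 toSubset)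
    (sum-cong-≗ λ i → cong (if_then 1 else 0)
      (does-⇔ (mk⇔ ∈-toSubset⁻ ∈-toSubset⁺) (i ∈? toSubset) (P? i)))

true≢false : true ≢ false
true≢false ()

∧-≡-true⁻ : ∀ {a b} → a ∧ b ≡ true → a ≡ true × b ≡ true
∧-≡-true⁻ {true} {true} refl = refl , refl

allᵇ-∈ : ∀ {A : Set} {p : A → Bool} {xs x} → T (allᵇ p xs) → x ∈ᴸ xs → T (p x)
allᵇ-∈ {xs = y ∷ ys} all-p (here refl) = proj₁ (to T-∧ all-p)
allᵇ-∈ {xs = y ∷ ys} all-p (there x∈) = allᵇ-∈ (proj₂ (to T-∧ all-p)) x∈

Isolated : (G : Graph) → V G → Set
Isolated G v = ∀ w → adj G v w ≡ false

isolated? : (G : Graph) → Decidable (T ∘ isIsolatedᵇ G)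
isolated? G = T? ∘ isIsolatedᵇ G

ι : (G : Graph) → V (minusIsolated G) → V G
ι G = lookup (nonIsolatedList G)

module _ (G : Graph) where

  isIsolatedᵇ-sound : ∀ {v} → T (isIsolatedᵇ G v) → Isolated G v
  isIsolatedᵇ-sound iso w = to T-not-≡ (allᵇ-∈ iso (∈-allFin w))

  neighbour-nonIsolated : ∀ {u w} → adj G u w ≡ true → T (not (isIsolatedᵇ G w))
  neighbour-nonIsolated {u} {w} uw with isIsolatedᵇ G w in iso
  ... | false = _
  ... | true  =
    true≢false (trans (sym uw) (trans (symm G u w) (isIsolatedᵇ-sound (from T-≡ iso) u)))

  ι-surjective : ∀ {v} → T (not (isIsolatedᵇ G v)) → ∃ λ i → ι G i ≡ v
  ι-surjective {v} nonIso = index v∈ , sym (lookup-index v∈)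
    where
    v∈ : v ∈ᴸ nonIsolatedList G
    v∈ = ∈-filter⁺ (T? ∘ not ∘ isIsolatedᵇ G) (∈-allFin v) nonIso

  ∑-isolated-ι : (c : V G → ℕ) → ∑[ v < order G ] c v
    ≡ sumᴸ (map c (isolatedList G)) + ∑[ i < order (minusIsolated G) ] c (ι G i)
  ∑-isolated-ι c = begin
    ∑[ v < order G ] c v
      ≡⟨ sumᴸ-map-tabulate (order G) id c ⟨
    sumᴸ (map c (allFin (order G)))
      ≡⟨ sumᴸ-map-filterᵇ-partition (isIsolatedᵇ G) c (allFin (order G)) ⟩
    sumᴸ (map c (isolatedList G)) + sumᴸ (map c (nonIsolatedList G))
      ≡⟨ cong (λ xs → sumᴸ (map c (isolatedList G)) + sumᴸ (map c xs))
              (tabulate-lookup (nonIsolatedList G)) ⟨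
    sumᴸ (map c (isolatedList G)) + sumᴸ (map c (List.tabulate (ι G)))
      ≡⟨ cong (sumᴸ (map c (isolatedList G)) +_) (sumᴸ-map-tabulate _ (ι G) c) ⟩
    sumᴸ (map c (isolatedList G)) + ∑[ i < order (minusIsolated G) ] c (ι G i) ∎
    where open ≡-Reasoning

  order≡numIsolated+order⁻ : order G ≡ numIsolated G + order (minusIsolated G)
  order≡numIsolated+order⁻ = begin
    order G                                                   ≡⟨ *-identityʳ (order G) ⟨
    order G * 1                                               ≡⟨ ∑-const (order G) 1 ⟨
    ∑[ v < order G ] 1                                        ≡⟨ ∑-isolated-ι (λ _ → 1) ⟩
    sumᴸ (map (λ _ → 1) (isolatedList G)) + ∑[ i < order (minusIsolated G) ] 1
      ≡⟨ cong₂ _+_ (sumᴸ-map-const 1 (isolatedList G)) (∑-const (order (minusIsolated G)) 1) ⟩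
    numIsolated G * 1 + order (minusIsolated G) * 1
      ≡⟨ cong₂ _+_ (*-identityʳ (numIsolated G)) (*-identityʳ (order (minusIsolated G))) ⟩
    numIsolated G + order (minusIsolated G)                   ∎
    where open ≡-Reasoning

PackingOn : (G : Graph) → (V G → Set) → Set
PackingOn G S = ∀ u v → S u → S v → u ≢ v →
  ∀ w → ¬ (InClosedNbhd G u w × InClosedNbhd G v w)

OpenPackingOn : (G : Graph) → (V G → Set) → Set
OpenPackingOn G S = ∀ u v → S u → S v → u ≢ v →
  ∀ w → ¬ (InOpenNbhd G u w × InOpenNbhd G v w)

module _ (G : Graph) where

  packing⇒¬adj : ∀ {S u v} → PackingOn G S → S u → S v → adj G u v ≢ true
  packing⇒¬adj {u = u} {v} pack su sv uv with u ≟ v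
  ... | yes refl = true≢false (trans (sym uv) (irrefl G u))
  ... | no u≢v   = pack u v su sv u≢v v (inj₂ uv , inj₁ refl)

  packingOn-⊆ : ∀ {S R} → (∀ {v} → R v → S v) → PackingOn G S → PackingOn G R
  packingOn-⊆ R⊆S pack u v ru rv = pack u v (R⊆S ru) (R⊆S rv)

  isolated-closedNbhd : ∀ {u w} → Isolated G u → InClosedNbhd G u w → w ≡ u
  isolated-closedNbhd         iso (inj₁ w≡u) = w≡u
  isolated-closedNbhd {w = w} iso (inj₂ uw)  = contradiction (trans (sym uw) (iso w)) true≢false

  isolated-∉-closedNbhd : ∀ {u v} → Isolated G u → u ≢ v → ¬ InClosedNbhd G v u
  isolated-∉-closedNbhd iso u≢v (inj₁ u≡v) = u≢v u≡v
  isolated-∉-closedNbhd {u} {v} iso u≢v (inj₂ vu) =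
    true≢false (trans (sym vu) (trans (symm G v u) (iso v)))

  packingOn-⊎-isolated : ∀ {S} → PackingOn G S → PackingOn G (λ v → S v ⊎ Isolated G v)
  packingOn-⊎-isolated pack u v (inj₂ iso) _ u≢v w (uw , vw)
    with refl ← isolated-closedNbhd iso uw = isolated-∉-closedNbhd iso u≢v vw
  packingOn-⊎-isolated pack u v _ (inj₂ iso) u≢v w (uw , vw)
    with refl ← isolated-closedNbhd iso vw = isolated-∉-closedNbhd iso (≢-sym u≢v) uw
  packingOn-⊎-isolated pack u v (inj₁ su) (inj₁ sv) = pack u v su sv

Image : (G : Graph) → Subset (order (minusIsolated G)) → V G → Set
Image G A v = ∃ λ i → i ∈ A × ι G i ≡ v

image? : (G : Graph) (A : Subset (order (minusIsolated G))) → Decidable (Image G A)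
image? G A v = any? λ i → i ∈? A ×-dec ι G i ≟ v

module _ (G : Graph) {A : Subset (order (minusIsolated G))} where

  openPacking-image : IsOpenPacking (minusIsolated G) A → OpenPackingOn G (Image G A)
  openPacking-image open-A _ _ (i , i∈A , refl) (j , j∈A , refl) ιi≢ιj w (iw , jw)
    with t , refl ← ι-surjective G (neighbour-nonIsolated G iw)
    = open-A i j i∈A j∈A (ιi≢ιj ∘ cong (ι G)) t (iw , jw)

  packing-image : IsPacking (minusIsolated G) A → PackingOn G (Image G A)
  packing-image pack-A _ _ (i , i∈A , refl) (j , j∈A , refl) ιi≢ιj w (iw , jw) = clash iw jw
    where
    i≢j : i ≢ j
    i≢j = ιi≢ιj ∘ cong (ι G)
    clash : ∀ {w} → InClosedNbhd G (ι G i) w → ¬ InClosedNbhd G (ι G j) w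
    clash (inj₁ refl) (inj₁ ιi≡ιj) = ιi≢ιj ιi≡ιj
    clash (inj₁ refl) (inj₂ jw)    = pack-A i j i∈A j∈A i≢j i (inj₁ refl , inj₂ jw)
    clash (inj₂ iw)   (inj₁ refl)  = pack-A i j i∈A j∈A i≢j j (inj₂ iw , inj₁ refl)
    clash (inj₂ iw)   (inj₂ jw)
      with t , refl ← ι-surjective G (neighbour-nonIsolated G iw)
      = pack-A i j i∈A j∈A i≢j t (inj₂ iw , inj₂ jw)

module _ (X Y : Graph) where

  InClosedNbhd² : V X × V Y → V X × V Y → Set
  InClosedNbhd² (a , b) (x , y) = (x ≡ a × y ≡ b) ⊎ (adj X a x ≡ true × adj Y b y ≡ true)

  openPacking×packing : ∀ {S R} → OpenPackingOn X S → PackingOn Y R →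
    ∀ {a b a' b' p} → S a → R b → S a' → R b' → (a , b) ≢ (a' , b') →
    ¬ (InClosedNbhd² (a , b) p × InClosedNbhd² (a' , b') p)
  openPacking×packing _ _ _ _ _ _ ab≢a'b' (inj₁ (refl , refl) , inj₁ (a≡a' , b≡b')) =
    ab≢a'b' (cong₂ _,_ a≡a' b≡b')
  openPacking×packing _ pack-R _ rb _ rb' _ (inj₁ (refl , refl) , inj₂ (_ , b'b)) =
    packing⇒¬adj Y pack-R rb' rb b'b
  openPacking×packing _ pack-R _ rb _ rb' _ (inj₂ (_ , bb') , inj₁ (refl , refl)) =
    packing⇒¬adj Y pack-R rb rb' bb'
  openPacking×packing open-S pack-R {a} {b} {a'} {b'} {x , y} sa rb sa' rb' ab≢a'b'
    (inj₂ (ax , by) , inj₂ (a'x , b'y)) with a ≟ a'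
  ... | no a≢a'  = open-S a a' sa sa' a≢a' x (ax , a'x)
  ... | yes refl = pack-R b b' rb rb' (ab≢a'b' ∘ cong (a ,_)) y (inj₂ by , inj₂ b'y)

InClosedNbhd²-swap : ∀ X Y {a b x y} →
  InClosedNbhd² X Y (a , b) (x , y) → InClosedNbhd² Y X (b , a) (y , x)
InClosedNbhd²-swap X Y = Sum.map swap swap

module _ (X Y : Graph) where

  private
    X×Y = directProduct X Y

  coords : V X×Y → V X × V Y
  coords = remQuot {order X} (order Y)

  closedNbhd-coords : ∀ {u w} → InClosedNbhd X×Y u w → InClosedNbhd² X Y (coords u) (coords w)
  closedNbhd-coords (inj₁ refl) = inj₁ (refl , refl)
  closedNbhd-coords (inj₂ uw)   = inj₂ (∧-≡-true⁻ uw)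

  coords-injective : ∀ {u v} → u ≢ v → coords u ≢ coords v
  coords-injective {u} {v} u≢v eq = u≢v (begin
    u                             ≡⟨ combine-remQuot {order X} (order Y) u ⟨
    uncurry combine (coords u)    ≡⟨ cong (uncurry combine) eq ⟩
    uncurry combine (coords v)    ≡⟨ combine-remQuot {order X} (order Y) v ⟩
    v                             ∎)
    where open ≡-Reasoning

  isolated-× : ∀ {u} → Isolated X (proj₁ (coords u)) ⊎ Isolated Y (proj₂ (coords u)) →
               Isolated X×Y u
  isolated-× (inj₁ iso) w rewrite iso (proj₁ (coords w)) = refl
  isolated-× (inj₂ iso) w rewrite iso (proj₂ (coords w)) = ∧-zeroʳ _

  packing-×ˡ : ∀ {S R} → OpenPackingOn X S → PackingOn Y R →
               PackingOn X×Y (λ u → S (proj₁ (coords u)) × R (proj₂ (coords u)))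
  packing-×ˡ open-S pack-R u v (su , ru) (sv , rv) u≢v w (uw , vw) =
    openPacking×packing X Y open-S pack-R su ru sv rv (coords-injective u≢v)
      (closedNbhd-coords uw , closedNbhd-coords vw)

  packing-×ʳ : ∀ {S R} → PackingOn X S → OpenPackingOn Y R →
               PackingOn X×Y (λ u → S (proj₁ (coords u)) × R (proj₂ (coords u)))
  packing-×ʳ pack-S open-R u v (su , ru) (sv , rv) u≢v w (uw , vw) =
    openPacking×packing Y X open-R pack-S ru su rv sv (coords-injective u≢v ∘ cong swap)
      (InClosedNbhd²-swap X Y (closedNbhd-coords uw) ,
       InClosedNbhd²-swap X Y (closedNbhd-coords vw))

module ProductPacking (G H : Graph)
  (A : Subset (order (minusIsolated G))) (B : Subset (order (minusIsolated H))) where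

  private
    G×H = directProduct G H
    nG = order G
    nH = order H
    kG = order (minusIsolated G)
    kH = order (minusIsolated H)
    iG = numIsolated G
    iH = numIsolated H

  Chosen : V G → V H → Set
  Chosen g h = (Image G A g × Image H B h) ⊎ (T (isIsolatedᵇ G g) ⊎ T (isIsolatedᵇ H h))

  chosen? : ∀ g h → Dec (Chosen g h)
  chosen? g h = (image? G A g ×-dec image? H B h) ⊎-dec (isolated? G g ⊎-dec isolated? H h)

  chosenVertex? : (u : V G×H) → Dec (Chosen (proj₁ (coords G H u)) (proj₂ (coords G H u)))
  chosenVertex? u = chosen? (proj₁ (coords G H u)) (proj₂ (coords G H u))

  P : Subset (order G×H)
  P = toSubset chosenVertex?

  P-isPacking : (IsOpenPacking (minusIsolated G) A × IsPacking (minusIsolated H) B) ⊎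
              (IsPacking (minusIsolated G) A × IsOpenPacking (minusIsolated H) B) →
              IsPacking G×H P
  P-isPacking hyp = packingOn-⊆ G×H chosen-cases (packingOn-⊎-isolated G×H (image-packing hyp))
    where
    ImagePair : V G×H → Set
    ImagePair u = Image G A (proj₁ (coords G H u)) × Image H B (proj₂ (coords G H u))

    image-packing : (IsOpenPacking (minusIsolated G) A × IsPacking (minusIsolated H) B) ⊎
                    (IsPacking (minusIsolated G) A × IsOpenPacking (minusIsolated H) B) →
                    PackingOn G×H ImagePair
    image-packing (inj₁ (open-A , pack-B)) =
      packing-×ˡ G H (openPacking-image G open-A) (packing-image H pack-B)
    image-packing (inj₂ (pack-A , open-B)) =
      packing-×ʳ G H (packing-image G pack-A) (openPacking-image H open-B)

    chosen-cases : ∀ {u} → u ∈ P → ImagePair u ⊎ Isolated G×H u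
    chosen-cases u∈P =
      Sum.map₂ (isolated-× G H ∘ Sum.map (isIsolatedᵇ-sound G) (isIsolatedᵇ-sound H))
               (∈-toSubset⁻ chosenVertex? u∈P)

  row : V G → ℕ
  row g = ∑[ h < nH ] 𝟙 (chosen? g h)

  ∣P∣≡∑row : ∣ P ∣ ≡ ∑[ g < nG ] row g
  ∣P∣≡∑row = begin
    ∣ P ∣
      ≡⟨ ∣toSubset∣ chosenVertex? ⟩
    ∑[ u < nG * nH ] 𝟙 (chosen? (proj₁ (coords G H u)) (proj₂ (coords G H u)))
      ≡⟨ ∑-combine nG nH _ ⟩
    ∑[ g < nG ] ∑[ h < nH ] 𝟙 (chosenVertex? (combine g h))
      ≡⟨ sum-cong-≗ (λ g → sum-cong-≗ (λ h →
           cong (λ gh → 𝟙 (chosen? (proj₁ gh) (proj₂ gh))) (remQuot-combine g h))) ⟩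
    ∑[ g < nG ] row g ∎
    where open ≡-Reasoning

  row-isolated : ∀ {g} → T (isIsolatedᵇ G g) → nH ≤ row g
  row-isolated {g} iso = ≤-reflexive (begin
    nH                  ≡⟨ *-identityʳ nH ⟨
    nH * 1              ≡⟨ ∑-const nH 1 ⟨
    ∑[ h < nH ] 1       ≡⟨ sum-cong-≗ (λ h → 𝟙-yes (chosen? g h) (inj₂ (inj₁ iso))) ⟨
    row g               ∎)
    where open ≡-Reasoning

  row-ι : ∀ i → iH + 𝟙 (i ∈? A) * ∣ B ∣ ≤ row (ι G i)
  row-ι i = begin
    iH + 𝟙 (i ∈? A) * ∣ B ∣
      ≡⟨ cong₂ _+_ (sym (trans (sumᴸ-map-const 1 (isolatedList H)) (*-identityʳ iH)))
                   (𝟙*∣p∣≡∑𝟙-×-dec (i ∈? A) B) ⟩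
    sumᴸ (map (λ _ → 1) (isolatedList H)) + ∑[ j < kH ] 𝟙 (i ∈? A ×-dec j ∈? B)
      ≤⟨ +-mono-≤ (sumᴸ-map-filterᵇ-mono (isIsolatedᵇ H) isolated-column (allFin nH))
                  (∑-mono-≤ λ j → 𝟙-mono (λ (i∈A , j∈B) → inj₁ ((i , i∈A , refl) , (j , j∈B , refl)))
                                          (i ∈? A ×-dec j ∈? B) (chosen? (ι G i) (ι H j))) ⟩
    sumᴸ (map (λ h → 𝟙 (chosen? (ι G i) h)) (isolatedList H))
      + ∑[ j < kH ] 𝟙 (chosen? (ι G i) (ι H j))
      ≡⟨ ∑-isolated-ι H _ ⟨
    row (ι G i) ∎
    where
    open ≤-Reasoning
    isolated-column : ∀ h → T (isIsolatedᵇ H h) → 1 ≤ 𝟙 (chosen? (ι G i) h)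
    isolated-column h iso = ≤-reflexive (sym (𝟙-yes (chosen? (ι G i) h) (inj₂ (inj₂ iso))))

  count≤∣P∣ : iG * nH + kG * iH + ∣ A ∣ * ∣ B ∣ ≤ ∣ P ∣
  count≤∣P∣ = begin
    iG * nH + kG * iH + ∣ A ∣ * ∣ B ∣
      ≡⟨ +-assoc (iG * nH) _ _ ⟩
    iG * nH + (kG * iH + ∣ A ∣ * ∣ B ∣)
      ≡⟨ cong₂ _+_ (sumᴸ-map-const nH (isolatedList G)) non-isolated-rows ⟨
    sumᴸ (map (λ _ → nH) (isolatedList G)) + ∑[ i < kG ] (iH + 𝟙 (i ∈? A) * ∣ B ∣)
      ≤⟨ +-mono-≤ (sumᴸ-map-filterᵇ-mono (isIsolatedᵇ G) (λ _ → row-isolated) (allFin nG))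
                  (∑-mono-≤ row-ι) ⟩
    sumᴸ (map row (isolatedList G)) + ∑[ i < kG ] row (ι G i)
      ≡⟨ ∑-isolated-ι G row ⟨
    ∑[ g < nG ] row g
      ≡⟨ ∣P∣≡∑row ⟨
    ∣ P ∣ ∎
    where
    open ≤-Reasoning
    non-isolated-rows : ∑[ i < kG ] (iH + 𝟙 (i ∈? A) * ∣ B ∣) ≡ kG * iH + ∣ A ∣ * ∣ B ∣
    non-isolated-rows = trans (∑-distrib-+ (λ _ → iH) (λ i → 𝟙 (i ∈? A) * ∣ B ∣))
      (cong₂ _+_ (∑-const kG iH)
                 (trans (sym (*-distribʳ-sum ∣ B ∣ (λ i → 𝟙 (i ∈? A))))
                        (cong (_* ∣ B ∣) (sym (∣p∣≡∑𝟙 A)))))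

  bound≤∣P∣ : ∀ M → M ≤ ∣ A ∣ * ∣ B ∣ → M + iG * nH + iH * nG ∸ iG * iH ≤ ∣ P ∣
  bound≤∣P∣ M M≤∣A∣∣B∣ = begin
    M + iG * nH + iH * nG ∸ iG * iH
      ≡⟨ cong (λ n → M + iG * nH + iH * n ∸ iG * iH) (order≡numIsolated+order⁻ G) ⟩
    M + iG * nH + iH * (iG + kG) ∸ iG * iH
      ≡⟨ cong (_∸ iG * iH) (regroup M iG iH nH kG) ⟩
    iG * nH + kG * iH + M + iG * iH ∸ iG * iH
      ≡⟨ m+n∸n≡m (iG * nH + kG * iH + M) (iG * iH) ⟩
    iG * nH + kG * iH + M
      ≤⟨ +-monoʳ-≤ (iG * nH + kG * iH) M≤∣A∣∣B∣ ⟩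
    iG * nH + kG * iH + ∣ A ∣ * ∣ B ∣
      ≤⟨ count≤∣P∣ ⟩
    ∣ P ∣ ∎
    where
    open ≤-Reasoning
    regroup : ∀ m a b c d → m + a * c + b * (a + d) ≡ a * c + d * b + m + a * b
    regroup = solve-∀

theorem11 : (G H : Graph) (ρoG⁻ ρG⁻ ρoH⁻ ρH⁻ : ℕ) →
    IsOpenPackingNumber (minusIsolated G) ρoG⁻ →
    IsPackingNumber (minusIsolated G) ρG⁻ →
    IsOpenPackingNumber (minusIsolated H) ρoH⁻ →
    IsPackingNumber (minusIsolated H) ρH⁻ →
    Σ (Subset (order (directProduct G H))) λ P →
      IsPacking (directProduct G H) P ×
      ∣ P ∣ ≥ ((ρoG⁻ * ρH⁻) ⊔ (ρoH⁻ * ρG⁻))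
               + numIsolated G * order H + numIsolated H * order G
               ∸ numIsolated G * numIsolated H
theorem11 G H _ _ _ _ ((Ao , open-Ao , refl) , _) ((A , pack-A , refl) , _)
                      ((Bo , open-Bo , refl) , _) ((B , pack-B , refl) , _)
  with ≤-total (∣ Bo ∣ * ∣ A ∣) (∣ Ao ∣ * ∣ B ∣)
... | inj₁ ∣Bo∣∣A∣≤∣Ao∣∣B∣ =
  P , P-isPacking (inj₁ (open-Ao , pack-B)) ,
  bound≤∣P∣ _ (⊔-lub ≤-refl ∣Bo∣∣A∣≤∣Ao∣∣B∣)
  where open ProductPacking G H Ao B
... | inj₂ ∣Ao∣∣B∣≤∣Bo∣∣A∣ =
  P , P-isPacking (inj₂ (pack-A , open-Bo)) ,
  bound≤∣P∣ _ (≤-trans (⊔-lub ∣Ao∣∣B∣≤∣Bo∣∣A∣ ≤-refl) (≤-reflexive (*-comm ∣ Bo ∣ ∣ A ∣)))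
  where open ProductPacking G H A Bo
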